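{- Let $\mathcal{C}$ be a small category, let $(X_i)_{i\in I}$ be a filtering system in $\mathcal{C}$, and let $Y$ be an object of $\mathcal{C}$. Let $f:\mathrm{Ind}((X_i))\to Y$ and $g:Y\to X_0$ be morphisms, where $X_0$ is one of the objects of the system, and for each $i$ let $f_i:X_i\to Y$ denote the composite of the canonical morphism $X_i\to \mathrm{Ind}((X_i))$ with $f$. Assume $f_0\circ g=\mathrm{id}_Y$. Assume moreover that for every $i$ there is a morphism $t_i:X_i\to X_j$ of the system such that for every object $V$ and any two morphisms $h_1,h_2:V\to X_i$, if $f_i\circ h_1=f_i\circ h_2$ then $t_i\circ h_1=t_i\circ h_2$. Then $f$ is an isomorphism, whose inverse is $g$ (i.e., the composite of $g$ with the canonical morphism $X_0\to\mathrm{Ind}((X_i))$).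
   Context: A filtering category is a small category $I$ such that (i) for any objects $i,j$ there are morphisms $i\to k$, $j\to k$ for some object $k$, and (ii) for any two morphisms $t_1,t_2:i\to j$ there is $s:j\to k$ with $s\circ t_1=s\circ t_2$. A filtering system in $\mathcal{C}$ is a functor from a filtering category to $\mathcal{C}$, written $(X_i)$. Let $\mathbf{y}:\mathcal{C}\to\mathrm{Pre}(\mathcal{C})$ be the Yoneda embedding into presheaves (contravariant functors $\mathcal{C}\to\mathrm{Set}$), $\mathbf{y}(X)(Z)=\mathrm{Hom}(Z,X)$. The ind-object $\mathrm{Ind}((X_i))$ is the presheaf $\varinjlim_i \mathbf{y}(X_i)$, so $\mathrm{Hom}(Z,\mathrm{Ind}((X_i)))=\varinjlim_i\mathrm{Hom}(Z,X_i)$ for objects $Z$; objects of $\mathcal{C}$ are identified with their images under $\mathbf{y}$, and morphisms are morphisms of presheaves. -}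

module Defs where

open import Level using (0ℓ)
open import Data.Product using (Σ; Σ-syntax; _×_; _,_; proj₁; proj₂)
open import Relation.Binary.Bundles using (Setoid)
open import Relation.Binary.PropositionalEquality
  using (_≡_; refl; sym; trans; cong; cong₂)
open import Relation.Binary.Construct.Closure.Equivalence
  using (EqClosure; gmap) renaming (setoid to eqSetoid)
open import Relation.Binary.Construct.Closure.ReflexiveTransitive using (ε)

record Category : Set₁ where
  infixr 9 _∘_
  field
    Obj  : Set
    Hom  : Obj → Obj → Set
    id   : ∀ {A} → Hom A A
    _∘_  : ∀ {A B C} → Hom B C → Hom A B → Hom A C
    identityˡ : ∀ {A B} (f : Hom A B) → id ∘ f ≡ f
    identityʳ : ∀ {A B} (f : Hom A B) → f ∘ id ≡ f
    assoc : ∀ {A B C D} (f : Hom C D) (g : Hom B C) (h : Hom A B)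
          → (f ∘ g) ∘ h ≡ f ∘ (g ∘ h)

record IsFiltering (I : Category) : Set where
  open Category I
  field
    upper : ∀ (i j : Obj) → Σ[ k ∈ Obj ] (Hom i k × Hom j k)
    equalize : ∀ {i j} (t₁ t₂ : Hom i j)
             → Σ[ k ∈ Obj ] Σ[ s ∈ Hom j k ] (s ∘ t₁ ≡ s ∘ t₂)

-- Functors (a filtering system in C is a functor I → C, I filtering)
record Functor (I C : Category) : Set where
  private
    module I = Category I
    module C = Category C
  field
    F₀ : I.Obj → C.Obj
    F₁ : ∀ {i j} → I.Hom i j → C.Hom (F₀ i) (F₀ j)
    F-id : ∀ {i} → F₁ (I.id {i}) ≡ C.id
    F-∘ : ∀ {i j k} (u : I.Hom j k) (v : I.Hom i j)
        → F₁ (u I.∘ v) ≡ F₁ u C.∘ F₁ v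

-- Presheaves on C (contravariant functors C → Set; sets presented as
-- setoids, since Agda has no quotient types) and their morphisms.

module _ (C : Category) where
  open Category C

  record Presheaf : Set₁ where
    field
      P₀ : Obj → Setoid 0ℓ 0ℓ
    open module S {Z} = Setoid (P₀ Z) using (Carrier; _≈_)
    field
      P₁ : ∀ {Z W} → Hom W Z → Carrier {Z} → Carrier {W}
      P₁-cong : ∀ {Z W} (h : Hom W Z) {x y : Carrier {Z}}
              → x ≈ y → P₁ h x ≈ P₁ h y
      P-id : ∀ {Z} (x : Carrier {Z}) → P₁ id x ≈ x
      P-∘ : ∀ {Z W U} (h : Hom W Z) (k : Hom U W) (x : Carrier {Z})
          → P₁ (h ∘ k) x ≈ P₁ k (P₁ h x)

  open Presheaf

  El : Presheaf → Obj → Set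
  El P Z = Setoid.Carrier (P₀ P Z)

  record PMor (P Q : Presheaf) : Set where
    field
      η : ∀ Z → El P Z → El Q Z
      η-cong : ∀ Z {x y} → Setoid._≈_ (P₀ P Z) x y
             → Setoid._≈_ (P₀ Q Z) (η Z x) (η Z y)
      natural : ∀ {Z W} (h : Hom W Z) (x : El P Z)
              → Setoid._≈_ (P₀ Q W) (η W (P₁ P h x)) (P₁ Q h (η Z x))
  open PMor

  idP : ∀ {P} → PMor P P
  idP {P} = record
    { η = λ Z x → x
    ; η-cong = λ Z e → e
    ; natural = λ h x → Setoid.refl (P₀ P _) }

  _∘P_ : ∀ {P Q R} → PMor Q R → PMor P Q → PMor P R
  _∘P_ {P} {Q} {R} α β = record
    { η = λ Z x → η α Z (η β Z x)
    ; η-cong = λ Z e → η-cong α Z (η-cong β Z e)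
    ; natural = λ h x → Setoid.trans (P₀ R _)
        (η-cong α _ (natural β h x)) (natural α h (η β _ x)) }

  _≈P_ : ∀ {P Q} → PMor P Q → PMor P Q → Set
  _≈P_ {P} {Q} α β = ∀ Z (x : El P Z) → Setoid._≈_ (P₀ Q Z) (η α Z x) (η β Z x)

  IsInverse : ∀ {P Q} → PMor P Q → PMor Q P → Set
  IsInverse {P} {Q} f g = ((g ∘P f) ≈P idP) × ((f ∘P g) ≈P idP)

  ≡-setoid : Set → Setoid 0ℓ 0ℓ
  ≡-setoid A = record
    { Carrier = A ; _≈_ = _≡_
    ; isEquivalence = record { refl = refl ; sym = sym ; trans = trans } }

  yo : Obj → Presheaf
  yo X = record
    { P₀ = λ Z → ≡-setoid (Hom Z X)
    ; P₁ = λ h a → a ∘ h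
    ; P₁-cong = λ h e → cong (_∘ h) e
    ; P-id = identityʳ
    ; P-∘ = λ h k x → sym (assoc x h k) }

  yo₁ : ∀ {X X'} → Hom X X' → PMor (yo X) (yo X')
  yo₁ u = record
    { η = λ Z a → u ∘ a
    ; η-cong = λ Z e → cong (u ∘_) e
    ; natural = λ h a → sym (assoc u a h) }

-- Ind-objects: Ind((X_i)) = colim_i y(X_i), computed pointwise as the
-- colimit of sets: Σ_i Hom(Z, X_i) modulo the equivalence relation
-- generated by (i , a) ~ (j , X(u) ∘ a) for u : i → j.

module _ {I C : Category} (X : Functor I C) where
  private
    module I = Category I
  open Category C
  open Functor X

  data Step (Z : Obj) : Σ I.Obj (λ i → Hom Z (F₀ i))
                      → Σ I.Obj (λ i → Hom Z (F₀ i)) → Set where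
    step : ∀ {i j} (u : I.Hom i j) (a : Hom Z (F₀ i)) (b : Hom Z (F₀ j))
         → b ≡ F₁ u ∘ a → Step Z (i , a) (j , b)

  private
    ≡⇒clo : ∀ {Z} {x y : Σ I.Obj (λ i → Hom Z (F₀ i))}
          → x ≡ y → EqClosure (Step Z) x y
    ≡⇒clo refl = ε

    pre : ∀ {Z W} → Hom W Z → Σ I.Obj (λ i → Hom Z (F₀ i))
        → Σ I.Obj (λ i → Hom W (F₀ i))
    pre h (i , a) = i , a ∘ h

    pre-step : ∀ {Z W} (h : Hom W Z) {x y} → Step Z x y → Step W (pre h x) (pre h y)
    pre-step h (step u a b e) =
      step u (a ∘ h) (b ∘ h) (trans (cong (_∘ h) e) (assoc (F₁ u) a h))

  Ind : Presheaf C
  Ind = record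
    { P₀ = λ Z → eqSetoid (Step Z)
    ; P₁ = pre
    ; P₁-cong = λ h → gmap (pre h) (pre-step h)
    ; P-id = λ { (i , a) → ≡⇒clo (cong (i ,_) (identityʳ a)) }
    ; P-∘ = λ { h k (i , a) → ≡⇒clo (cong (i ,_) (sym (assoc a h k))) } }

  ι : ∀ i → PMor C (yo C (F₀ i)) Ind
  ι i = record
    { η = λ Z a → i , a
    ; η-cong = λ Z e → ≡⇒clo (cong (i ,_) e)
    ; natural = λ h a → ε }

  -- for f : Ind((X_i)) → y(Y), the morphism f_i : X_i → Y of C
  -- corresponding (Yoneda) to the composite f ∘ ι_i
  component : ∀ {Y} → PMor C Ind (yo C Y) → ∀ i → Hom (F₀ i) Y
  component f i = PMor.η (_∘P_ C f (ι i)) (F₀ i) id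

-- The canonical maps ι_i form a cocone, and f ∘ ι_i = f_i by Yoneda, so f ∘ (ι_{i₀} ∘ g) = f_{i₀} ∘ g = id.
-- Conversely, ι_i and ι_{i₀} ∘ g ∘ f_i are identified in the colimit: map i and i₀ to a common k;
-- the two resulting maps X_i → X_k become equal after f_k, hence after the given t : X_k → X_j.
module Submission where

open import Defs
open import Data.Product using (Σ; Σ-syntax; _×_; _,_; proj₁; proj₂)
open import Relation.Binary.Bundles using (Setoid)
open import Relation.Binary.PropositionalEquality
open import Relation.Binary.Construct.Closure.ReflexiveTransitive using (ε; _◅_)
open import Relation.Binary.Construct.Closure.Symmetric using (fwd; bwd)

module _ {C I : Category} (X : Functor I C) where
  private
    module I = Category I
  open Category C
  open Functor X
  open PMor

  _≈Ind_ : ∀ {Z} → El C (Ind X) Z → El C (Ind X) Z → Set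
  _≈Ind_ {Z} = Setoid._≈_ (Presheaf.P₀ (Ind X) Z)

  Ind-≈-glue : ∀ {Z i j k} (a : Hom Z (F₀ i)) (b : Hom Z (F₀ j))
             (u : I.Hom i k) (v : I.Hom j k)
             → F₁ u ∘ a ≡ F₁ v ∘ b → (i , a) ≈Ind (j , b)
  Ind-≈-glue a b u v e = fwd (step u a _ refl) ◅ bwd (step v b (F₁ u ∘ a) e) ◅ ε

  module _ {Y : Obj} (f : PMor C (Ind X) (yo C Y)) where

    private
      f⟨_⟩ : ∀ i → Hom (F₀ i) Y
      f⟨ i ⟩ = component X f i

    component-η : ∀ {Z i} (a : Hom Z (F₀ i)) → η f Z (i , a) ≡ f⟨ i ⟩ ∘ a
    component-η {Z} {i} a =
      trans (cong (λ b → η f Z (i , b)) (sym (identityˡ a))) (natural f a (i , id))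

    component-cocone : ∀ {i k} (u : I.Hom i k) → f⟨ k ⟩ ∘ F₁ u ≡ f⟨ i ⟩
    component-cocone u = trans (sym (component-η (F₁ u)))
      (η-cong f _ (bwd (step u id (F₁ u) (sym (identityʳ _))) ◅ ε))

    Absorbs : ∀ {i j} → I.Hom i j → Set
    Absorbs {i} u = ∀ (V : Obj) (h₁ h₂ : Hom V (F₀ i))
      → f⟨ i ⟩ ∘ h₁ ≡ f⟨ i ⟩ ∘ h₂ → F₁ u ∘ h₁ ≡ F₁ u ∘ h₂

    module _ {i₀ : I.Obj} (g : Hom Y (F₀ i₀)) (fg : f⟨ i₀ ⟩ ∘ g ≡ id) where

      section-cancelˡ : ∀ {Z} (y : Hom Z Y) → f⟨ i₀ ⟩ ∘ (g ∘ y) ≡ y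
      section-cancelˡ y = begin
        f⟨ i₀ ⟩ ∘ (g ∘ y) ≡⟨ sym (assoc _ g y) ⟩
        (f⟨ i₀ ⟩ ∘ g) ∘ y ≡⟨ cong (_∘ y) fg ⟩
        id ∘ y            ≡⟨ identityˡ y ⟩
        y                 ∎
        where open ≡-Reasoning

      f∘ι∘g≈id : _≈P_ C (_∘P_ C f (_∘P_ C (ι X i₀) (yo₁ C g))) (idP C)
      f∘ι∘g≈id Z y = trans (component-η (g ∘ y)) (section-cancelˡ y)

      module _ (upper : ∀ (i j : I.Obj) → Σ[ k ∈ I.Obj ] (I.Hom i k × I.Hom j k))
               (absorbing : ∀ i → Σ[ j ∈ I.Obj ] Σ[ t ∈ I.Hom i j ] Absorbs t) where

        ι-identifies-g∘component : ∀ i → Σ[ k ∈ I.Obj ] Σ[ u ∈ I.Hom i k ] Σ[ v ∈ I.Hom i₀ k ]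
          (F₁ u ≡ F₁ v ∘ (g ∘ f⟨ i ⟩))
        ι-identifies-g∘component i =
          j , t I.∘ u , t I.∘ v , (begin
            F₁ (t I.∘ u)                 ≡⟨ F-∘ t u ⟩
            F₁ t ∘ F₁ u                  ≡⟨ absorbs-t _ (F₁ u) _ agree ⟩
            F₁ t ∘ (F₁ v ∘ (g ∘ f⟨ i ⟩)) ≡⟨ sym (assoc _ _ _) ⟩
            (F₁ t ∘ F₁ v) ∘ (g ∘ f⟨ i ⟩) ≡⟨ cong (_∘ (g ∘ f⟨ i ⟩)) (sym (F-∘ t v)) ⟩
            F₁ (t I.∘ v) ∘ (g ∘ f⟨ i ⟩)  ∎)
          where
          open ≡-Reasoning
          k = proj₁ (upper i i₀)
          u = proj₁ (proj₂ (upper i i₀))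
          v = proj₂ (proj₂ (upper i i₀))
          j = proj₁ (absorbing k)
          t = proj₁ (proj₂ (absorbing k))
          absorbs-t = proj₂ (proj₂ (absorbing k))

          agree : f⟨ k ⟩ ∘ F₁ u ≡ f⟨ k ⟩ ∘ (F₁ v ∘ (g ∘ f⟨ i ⟩))
          agree = begin
            f⟨ k ⟩ ∘ F₁ u                  ≡⟨ component-cocone u ⟩
            f⟨ i ⟩                         ≡⟨ sym (section-cancelˡ _) ⟩
            f⟨ i₀ ⟩ ∘ (g ∘ f⟨ i ⟩)         ≡⟨ cong (_∘ (g ∘ f⟨ i ⟩)) (sym (component-cocone v)) ⟩
            (f⟨ k ⟩ ∘ F₁ v) ∘ (g ∘ f⟨ i ⟩) ≡⟨ assoc _ _ _ ⟩
            f⟨ k ⟩ ∘ (F₁ v ∘ (g ∘ f⟨ i ⟩)) ∎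

        ι∘g∘f≈id : _≈P_ C (_∘P_ C (_∘P_ C (ι X i₀) (yo₁ C g)) f) (idP C)
        ι∘g∘f≈id Z (i , a) with ι-identifies-g∘component i
        ... | k , u , v , e = Ind-≈-glue (g ∘ η f Z (i , a)) a v u (begin
          F₁ v ∘ (g ∘ η f Z (i , a)) ≡⟨ cong (λ b → F₁ v ∘ (g ∘ b)) (component-η a) ⟩
          F₁ v ∘ (g ∘ (f⟨ i ⟩ ∘ a))  ≡⟨ cong (F₁ v ∘_) (sym (assoc g _ a)) ⟩
          F₁ v ∘ ((g ∘ f⟨ i ⟩) ∘ a)  ≡⟨ sym (assoc (F₁ v) _ a) ⟩
          (F₁ v ∘ (g ∘ f⟨ i ⟩)) ∘ a  ≡⟨ cong (_∘ a) (sym e) ⟩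
          F₁ u ∘ a                   ∎)
          where open ≡-Reasoning

lemma2p1 : (C I : Category) → IsFiltering I → (X : Functor I C)
    → (Y : Category.Obj C) (i₀ : Category.Obj I)
    → (f : PMor C (Ind X) (yo C Y))
    → (g : Category.Hom C Y (Functor.F₀ X i₀))
    → Category._∘_ C (component X f i₀) g ≡ Category.id C
    → (∀ i → Σ[ j ∈ Category.Obj I ] Σ[ u ∈ Category.Hom I i j ]
          (∀ (V : Category.Obj C) (h₁ h₂ : Category.Hom C V (Functor.F₀ X i))
            → Category._∘_ C (component X f i) h₁ ≡ Category._∘_ C (component X f i) h₂
            → Category._∘_ C (Functor.F₁ X u) h₁ ≡ Category._∘_ C (Functor.F₁ X u) h₂))
    → IsInverse C f (_∘P_ C (ι X i₀) (yo₁ C g))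
lemma2p1 C I filtering X Y i₀ f g fg absorbing =
  ι∘g∘f≈id X f g fg (IsFiltering.upper filtering) absorbing , f∘ι∘g≈id X f g fg
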